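{- Let $\Gamma = \mathcal{X}_a(m,n,S,\ell)$ with $S=[\{a_0,b_0\},\dots,\{a_{m-1},b_{m-1}\}]$ and admissible parameters. Then $\Gamma \cong \mathcal{X}_a(m,n,S',\ell')$ for some $\ell' \in \mathbb{Z}_n$ and some admissible signature $S' = [\{a'_0,b'_0\},\dots,\{a'_{m-1},b'_{m-1}\}]$ such that $a'_i + b'_i = 0$ for each $i \in \mathbb{Z}_m$.
   Context: Graphs $\mathcal{X}_a(m,n,S,\ell)$ (admissible parameters): $m\ge 3$, $n\ge 4$ even, $\ell\in\mathbb{Z}_n$ of the same parity as $m$ (parity in $\mathbb{Z}_n$ well defined as $n$ is even), $a_0=1$, $b_0=-1$, and for $1\le i\le m-1$ distinct odd $a_i,b_i\in\mathbb{Z}_n$ with $\gcd(b_i-a_i,n)=2$; $S=[\{a_0,b_0\},\dots,\{a_{m-1},b_{m-1}\}]$ is the signature. Vertices $u_{i,j}$, $i\in\mathbb{Z}_m$, $j\in\mathbb{Z}_n$; edges $u_{i,j}u_{i+1,j}$ for integers $0\le i\le m-2$ and $j\equiv i\pmod 2$; $u_{m-1,j}u_{0,j+\ell}$ for $j\equiv m-1\pmod 2$; $u_{i,j}u_{i,j+a_i}$ and $u_{i,j}u_{i,j+b_i}$ for $0\le i\le m-1$ and $j\equiv i\pmod 2$. -}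

module Defs where

open import Data.Nat using (ℕ; zero; suc; _+_; _∸_; _<_; NonZero)
open import Data.Nat.DivMod using (_%_; m%n<n)
open import Data.Nat.GCD using (gcd)
open import Data.Fin using (Fin; toℕ; fromℕ<)
open import Data.Product using (Σ; _×_; _,_; proj₁; proj₂)
open import Data.Sum using (_⊎_)
open import Relation.Binary.PropositionalEquality using (_≡_; _≢_)
open import Function.Bundles using (_↔_; _⇔_; Inverse)

-- ℤ_n is represented by Fin n (canonical representatives 0,…,n-1).
module _ (n : ℕ) {{_ : NonZero n}} where

  _⊕_ : Fin n → Fin n → Fin n
  x ⊕ y = fromℕ< (m%n<n (toℕ x + toℕ y) n)

  _⊖_ : Fin n → Fin n → Fin n
  y ⊖ x = fromℕ< (m%n<n (toℕ y + (n ∸ toℕ x)) n)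

-- a signature: row i ↦ (a_i , b_i)   (the set {a_i,b_i} given as a pair)
Sig : ℕ → ℕ → Set
Sig m n = Fin m → Fin n × Fin n

-- parity of an element of ℤ_n (well defined since n is even) / of a row index
par : {k : ℕ} → Fin k → ℕ
par x = toℕ x % 2

-- Admissibility of (S, ℓ) for given m, n (the conditions on m, n themselves
-- — m ≥ 3, n ≥ 4 even — are stated separately in the theorem).
record Admissible (m n : ℕ) {{_ : NonZero n}} (S : Sig m n) (ℓ : Fin n) : Set where
  field
    row0 : ∀ (i : Fin m) → toℕ i ≡ 0 →
             (toℕ (proj₁ (S i)) ≡ 1 × toℕ (proj₂ (S i)) ≡ n ∸ 1)
           ⊎ (toℕ (proj₁ (S i)) ≡ n ∸ 1 × toℕ (proj₂ (S i)) ≡ 1)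
    oddA : ∀ (i : Fin m) → toℕ i ≢ 0 → par (proj₁ (S i)) ≡ 1
    oddB : ∀ (i : Fin m) → toℕ i ≢ 0 → par (proj₂ (S i)) ≡ 1
    distinct : ∀ (i : Fin m) → toℕ i ≢ 0 → proj₁ (S i) ≢ proj₂ (S i)
    gcd2 : ∀ (i : Fin m) → toℕ i ≢ 0 → gcd (toℕ ((n ⊖ proj₂ (S i)) (proj₁ (S i)))) n ≡ 2
    ℓ-par : par ℓ ≡ m % 2

Vtx : ℕ → ℕ → Set
Vtx m n = Fin m × Fin n

-- the listed (directed representatives of) edges of X_a(m,n,S,ℓ)
data Edge (m n : ℕ) {{_ : NonZero n}} (S : Sig m n) (ℓ : Fin n) : Vtx m n → Vtx m n → Set where
  vert  : (i i' : Fin m) (j : Fin n) → toℕ i' ≡ suc (toℕ i) → par j ≡ par i →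
          Edge m n S ℓ (i , j) (i' , j)
  wrap  : (i i' : Fin m) (j : Fin n) → suc (toℕ i) ≡ m → toℕ i' ≡ 0 → par j ≡ par i →
          Edge m n S ℓ (i , j) (i' , (n ⊕ j) ℓ)
  chordA : (i : Fin m) (j : Fin n) → par j ≡ par i →
          Edge m n S ℓ (i , j) (i , (n ⊕ j) (proj₁ (S i)))
  chordB : (i : Fin m) (j : Fin n) → par j ≡ par i →
          Edge m n S ℓ (i , j) (i , (n ⊕ j) (proj₂ (S i)))

Adj : (m n : ℕ) {{_ : NonZero n}} (S : Sig m n) (ℓ : Fin n) → Vtx m n → Vtx m n → Set
Adj m n S ℓ x y = Edge m n S ℓ x y ⊎ Edge m n S ℓ y x

Isomorphic : (m n : ℕ) {{_ : NonZero n}} → Sig m n → Fin n → Sig m n → Fin n → Set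
Isomorphic m n S ℓ S' ℓ' =
  Σ (Vtx m n ↔ Vtx m n) λ f →
    ∀ x y → Adj m n S ℓ x y ⇔ Adj m n S' ℓ' (Inverse.to f x) (Inverse.to f y)

module Submission where

-- Shifting, in every row i, the vertices u_{i,j} with j ≡ i (mod 2) by an even p_i and the
-- others by an even q_i maps X_a(m,n,S,ℓ) isomorphically onto X_a(m,n,S',ℓ') as soon as
-- q_{i+1} = p_i, ℓ + q_0 = p_{m-1} + ℓ', a_i + q_i = p_i + a'_i and b_i + q_i = p_i + b'_i;
-- evenness keeps the two parity classes of a row apart, so shifting back by -p_i, -q_i inverts it.
-- Choose even h_i with 2h_i = a_i + b_i: h_0 = 0, and for i ≥ 1 h_i = a_i + (b_i - a_i)/2, plus
-- n/2 when (b_i - a_i)/2 is even; then 4 divides b_i - a_i, so gcd(b_i - a_i, n) = 2 forces n/2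
-- to be odd. Taking p_i = h_0 + … + h_i, q_i = p_i - h_i, a'_i = a_i - h_i, b'_i = b_i - h_i and
-- ℓ' = ℓ - p_{m-1} satisfies all conditions, and a'_i + b'_i = a_i + b_i - 2h_i = 0.

open import Algebra.Bundles using (AbelianGroup; Monoid)
open import Algebra.Consequences.Propositional using (comm∧idˡ⇒id; comm∧invˡ⇒inv)
open import Algebra.Structures using (IsAbelianGroup)
open import Data.Fin using (Fin; zero; suc; toℕ; fromℕ)
open import Data.Fin.Properties using (toℕ-fromℕ; toℕ-fromℕ<; toℕ-injective; toℕ<n)
open import Data.Nat using (ℕ; zero; suc; _+_; _*_; _∸_; _≤_; _≟_; s<s; s≤s; z≤n; NonZero; >-nonZero⁻¹)
open import Data.Nat.DivMod
  using (_%_; _/_; _mod_; m%n<n; m%n%n≡m%n; %-distribˡ-+; m<n⇒m%n≡m; n%n≡0; m/n*n≡m; m/n≤m; m∣n⇒o%n%m≡o%m)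
open import Data.Nat.Divisibility using (_∣_; m%n≡0⇒n∣m; n∣m⇒m%n≡0; *-monoˡ-∣; >⇒∤)
open import Data.Nat.GCD using (gcd; gcd-greatest)
open import Data.Nat.Properties
  using (suc-injective; 1+n≢0; 0≢1+n; +-comm; +-assoc; +-identityʳ; *-comm; m∸n+n≡m; m+[n∸m]≡n; <⇒≤; ≤-<-trans)
open import Data.Product using (∃; Σ-syntax; _×_; _,_; proj₁; proj₂)
open import Data.Sum using (_⊎_; inj₁; inj₂)
import Data.Sum as Sum
open import Function using (_∘_)
open import Function.Bundles using (mk↔ₛ′; mk⇔)
open import Level using (0ℓ)
open import Relation.Binary.PropositionalEquality
  using (_≡_; _≢_; refl; sym; trans; cong; cong₂; subst; subst₂; module ≡-Reasoning)
open import Relation.Binary.PropositionalEquality.Algebra using (isMagma)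
open import Relation.Nullary using (¬_; Dec; yes; no; contradiction)

open import Defs

module AbelianGroupLemmas {c ℓ} (G : AbelianGroup c ℓ) where

  open AbelianGroup G
  open import Algebra.Properties.AbelianGroup G using (⁻¹-∙-comm; xyx⁻¹≈y)
  open import Algebra.Properties.CommutativeSemigroup commutativeSemigroup using (interchange)
  open import Algebra.Properties.Monoid monoid using (cancelˡ; cancelʳ)
  open import Relation.Binary.Reasoning.Setoid setoid

  xy∙y⁻¹≈x : ∀ x y → x ∙ y ∙ y ⁻¹ ≈ x
  xy∙y⁻¹≈x x y = cancelʳ (inverseʳ y) x

  xy⁻¹∙y≈x : ∀ x y → x ∙ y ⁻¹ ∙ y ≈ x
  xy⁻¹∙y≈x x y = cancelʳ (inverseˡ y) x

  x∙yx⁻¹≈y : ∀ x y → x ∙ (y ∙ x ⁻¹) ≈ y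
  x∙yx⁻¹≈y x y = begin
    x ∙ (y ∙ x ⁻¹)     ≈⟨ assoc x y (x ⁻¹) ⟨
    x ∙ y ∙ x ⁻¹       ≈⟨ xyx⁻¹≈y x y ⟩
    y                  ∎

  x∙y≈z∙w⇒w∙y⁻¹≈z⁻¹∙x : ∀ x y z w → x ∙ y ≈ z ∙ w → w ∙ y ⁻¹ ≈ z ⁻¹ ∙ x
  x∙y≈z∙w⇒w∙y⁻¹≈z⁻¹∙x x y z w eq = begin
    w ∙ y ⁻¹                 ≈⟨ ∙-congʳ (cancelˡ (inverseˡ z) w) ⟨
    z ⁻¹ ∙ (z ∙ w) ∙ y ⁻¹    ≈⟨ ∙-congʳ (∙-congˡ eq) ⟨
    z ⁻¹ ∙ (x ∙ y) ∙ y ⁻¹    ≈⟨ assoc (z ⁻¹) (x ∙ y) (y ⁻¹) ⟩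
    z ⁻¹ ∙ (x ∙ y ∙ y ⁻¹)    ≈⟨ ∙-congˡ (xy∙y⁻¹≈x x y) ⟩
    z ⁻¹ ∙ x                 ∎

  xz⁻¹∙[yz⁻¹]⁻¹≈xy⁻¹ : ∀ x y z → x ∙ z ⁻¹ ∙ (y ∙ z ⁻¹) ⁻¹ ≈ x ∙ y ⁻¹
  xz⁻¹∙[yz⁻¹]⁻¹≈xy⁻¹ x y z = begin
    x ∙ z ⁻¹ ∙ (y ∙ z ⁻¹) ⁻¹          ≈⟨ ∙-congˡ (⁻¹-∙-comm y (z ⁻¹)) ⟨
    x ∙ z ⁻¹ ∙ (y ⁻¹ ∙ z ⁻¹ ⁻¹)       ≈⟨ interchange x (z ⁻¹) (y ⁻¹) (z ⁻¹ ⁻¹) ⟩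
    x ∙ y ⁻¹ ∙ (z ⁻¹ ∙ z ⁻¹ ⁻¹)       ≈⟨ ∙-congˡ (inverseʳ (z ⁻¹)) ⟩
    x ∙ y ⁻¹ ∙ ε                      ≈⟨ identityʳ (x ∙ y ⁻¹) ⟩
    x ∙ y ⁻¹                          ∎

  y∙z≈u∙v⇒xy∙z≈xu∙v : ∀ x y z u v → y ∙ z ≈ u ∙ v → x ∙ y ∙ z ≈ x ∙ u ∙ v
  y∙z≈u∙v⇒xy∙z≈xu∙v x y z u v eq = begin
    x ∙ y ∙ z       ≈⟨ assoc x y z ⟩
    x ∙ (y ∙ z)     ≈⟨ ∙-congˡ eq ⟩
    x ∙ (u ∙ v)     ≈⟨ assoc x u v ⟨
    x ∙ u ∙ v       ∎

  z∙z≈x∙y⇒xz⁻¹∙yz⁻¹≈ε : ∀ x y z → z ∙ z ≈ x ∙ y → x ∙ z ⁻¹ ∙ (y ∙ z ⁻¹) ≈ ε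
  z∙z≈x∙y⇒xz⁻¹∙yz⁻¹≈ε x y z eq = begin
    x ∙ z ⁻¹ ∙ (y ∙ z ⁻¹)     ≈⟨ interchange x (z ⁻¹) y (z ⁻¹) ⟩
    x ∙ y ∙ (z ⁻¹ ∙ z ⁻¹)     ≈⟨ ∙-congʳ eq ⟨
    z ∙ z ∙ (z ⁻¹ ∙ z ⁻¹)     ≈⟨ ∙-congˡ (⁻¹-∙-comm z z) ⟩
    z ∙ z ∙ (z ∙ z) ⁻¹        ≈⟨ inverseʳ (z ∙ z) ⟩
    ε                         ∎

  y∙y≈z∙x⁻¹⇒xy∙xy≈x∙z : ∀ x y z → y ∙ y ≈ z ∙ x ⁻¹ → x ∙ y ∙ (x ∙ y) ≈ x ∙ z
  y∙y≈z∙x⁻¹⇒xy∙xy≈x∙z x y z eq = begin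
    x ∙ y ∙ (x ∙ y)           ≈⟨ interchange x y x y ⟩
    x ∙ x ∙ (y ∙ y)           ≈⟨ ∙-congˡ eq ⟩
    x ∙ x ∙ (z ∙ x ⁻¹)        ≈⟨ assoc x x (z ∙ x ⁻¹) ⟩
    x ∙ (x ∙ (z ∙ x ⁻¹))      ≈⟨ ∙-congˡ (x∙yx⁻¹≈y x z) ⟩
    x ∙ z                     ∎

  y∙y≈ε⇒xy∙xy≈x∙x : ∀ x y → y ∙ y ≈ ε → x ∙ y ∙ (x ∙ y) ≈ x ∙ x
  y∙y≈ε⇒xy∙xy≈x∙x x y eq = begin
    x ∙ y ∙ (x ∙ y)           ≈⟨ interchange x y x y ⟩
    x ∙ x ∙ (y ∙ y)           ≈⟨ ∙-congˡ eq ⟩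
    x ∙ x ∙ ε                 ≈⟨ identityʳ (x ∙ x) ⟩
    x ∙ x                     ∎

module PartialSums {c ℓ} (M : Monoid c ℓ) where

  open Monoid M using (Carrier; _≈_; _∙_; ∙-congˡ; assoc)
  private module M = Monoid M

  sum≤ : ∀ {k} → (Fin k → Carrier) → Fin k → Carrier
  sum≤ f zero    = f zero
  sum≤ f (suc i) = f zero ∙ sum≤ (f ∘ suc) i

  sum≤-suc : ∀ {k} (f : Fin k → Carrier) i i' → toℕ i' ≡ suc (toℕ i) → sum≤ f i' ≈ sum≤ f i ∙ f i'
  sum≤-suc f zero    (suc zero) _   = M.refl
  sum≤-suc f (suc i) (suc i')   eq  =
    M.trans (∙-congˡ (sum≤-suc (f ∘ suc) i i' (suc-injective eq))) (M.sym (assoc (f zero) _ _))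
  sum≤-suc f zero (suc (suc _)) ()
  sum≤-suc f (suc _) zero ()

%2≡0⊎%2≡1 : ∀ a → a % 2 ≡ 0 ⊎ a % 2 ≡ 1
%2≡0⊎%2≡1 a with a % 2 | m%n<n a 2
... | 0 | _ = inj₁ refl
... | 1 | _ = inj₂ refl
... | suc (suc _) | s<s (s<s ())

even+-%2 : ∀ a b → b % 2 ≡ 0 → (a + b) % 2 ≡ a % 2
even+-%2 a b b-even = begin
  (a + b) % 2           ≡⟨ %-distribˡ-+ a b 2 ⟩
  (a % 2 + b % 2) % 2   ≡⟨ cong (λ c → (a % 2 + c) % 2) b-even ⟩
  (a % 2 + 0) % 2       ≡⟨ cong (_% 2) (+-identityʳ (a % 2)) ⟩
  a % 2 % 2             ≡⟨ m%n%n≡m%n a 2 ⟩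
  a % 2                 ∎
  where open ≡-Reasoning

odd+odd-%2 : ∀ a b → a % 2 ≡ 1 → b % 2 ≡ 1 → (a + b) % 2 ≡ 0
odd+odd-%2 a b a-odd b-odd =
  trans (%-distribˡ-+ a b 2) (cong₂ (λ c d → (c + d) % 2) a-odd b-odd)

odd+-%2≢ : ∀ a b → a % 2 ≡ 1 → (a + b) % 2 ≢ b % 2
odd+-%2≢ a b a-odd eq with %2≡0⊎%2≡1 b
... | inj₁ b-even = 1+n≢0 (trans (sym a-odd) (trans (sym (even+-%2 a b b-even)) (trans eq b-even)))
... | inj₂ b-odd  = 0≢1+n (trans (sym (odd+odd-%2 a b a-odd b-odd)) (trans eq b-odd))

[a+b]%2≡0⇒a%2≡b%2 : ∀ a b → (a + b) % 2 ≡ 0 → a % 2 ≡ b % 2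
[a+b]%2≡0⇒a%2≡b%2 a b eq with %2≡0⊎%2≡1 a | %2≡0⊎%2≡1 b
... | inj₁ a-even | inj₁ b-even = trans a-even (sym b-even)
... | inj₂ a-odd  | inj₂ b-odd  = trans a-odd (sym b-odd)
... | inj₁ a-even | inj₂ b-odd  =
  contradiction (trans (cong (_% 2) (+-comm b a)) eq) (λ e → odd+-%2≢ b a b-odd (trans e (sym a-even)))
... | inj₂ a-odd  | inj₁ b-even =
  contradiction eq (λ e → odd+-%2≢ a b a-odd (trans e (sym b-even)))

4∣m⇐2∣m∧2∣m/2 : ∀ m → 2 ∣ m → 2 ∣ m / 2 → 4 ∣ m
4∣m⇐2∣m∧2∣m/2 m 2∣m 2∣m/2 = subst (4 ∣_) (m/n*n≡m 2∣m) (*-monoˡ-∣ 2 2∣m/2)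

[m/2]%2≡1 : ∀ m → 2 ∣ m → ¬ 4 ∣ m → (m / 2) % 2 ≡ 1
[m/2]%2≡1 m 2∣m 4∤m with %2≡0⊎%2≡1 (m / 2)
... | inj₁ m/2-even = contradiction (4∣m⇐2∣m∧2∣m/2 m 2∣m (m%n≡0⇒n∣m (m / 2) 2 m/2-even)) 4∤m
... | inj₂ m/2-odd  = m/2-odd

m*2≡m+m : ∀ m → m * 2 ≡ m + m
m*2≡m+m m = trans (*-comm m 2) (cong (m +_) (+-identityʳ m))

module ℤₙ (n : ℕ) {{_ : NonZero n}} where

  infixl 6 _+ₙ_ _-ₙ_

  _+ₙ_ : Fin n → Fin n → Fin n
  x +ₙ y = (n ⊕ x) y

  _-ₙ_ : Fin n → Fin n → Fin n
  y -ₙ x = (n ⊖ y) x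

  negₙ : Fin n → Fin n
  negₙ x = (n ∸ toℕ x) mod n

  0ₙ : Fin n
  0ₙ = 0 mod n

  toℕ-mod : ∀ k → toℕ (k mod n) ≡ k % n
  toℕ-mod k = toℕ-fromℕ< (m%n<n k n)

  mod-cong : ∀ {k l} → k % n ≡ l % n → k mod n ≡ l mod n
  mod-cong {k} {l} eq = toℕ-injective (trans (toℕ-mod k) (trans eq (sym (toℕ-mod l))))

  0%n≡0 : 0 % n ≡ 0
  0%n≡0 = m<n⇒m%n≡m (>-nonZero⁻¹ n)

  toℕ-0ₙ : toℕ 0ₙ ≡ 0
  toℕ-0ₙ = trans (toℕ-mod 0) 0%n≡0

  mod-toℕ : ∀ (x : Fin n) → toℕ x mod n ≡ x
  mod-toℕ x = toℕ-injective (trans (toℕ-mod (toℕ x)) (m<n⇒m%n≡m (toℕ<n x)))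

  %-absorbˡ : ∀ a b → (a % n + b) % n ≡ (a + b) % n
  %-absorbˡ a b = begin
    (a % n + b) % n             ≡⟨ %-distribˡ-+ (a % n) b n ⟩
    (a % n % n + b % n) % n     ≡⟨ cong (λ c → (c + b % n) % n) (m%n%n≡m%n a n) ⟩
    (a % n + b % n) % n         ≡⟨ %-distribˡ-+ a b n ⟨
    (a + b) % n                 ∎
    where open ≡-Reasoning

  %-absorbʳ : ∀ a b → (a + b % n) % n ≡ (a + b) % n
  %-absorbʳ a b = begin
    (a + b % n) % n     ≡⟨ cong (_% n) (+-comm a (b % n)) ⟩
    (b % n + a) % n     ≡⟨ %-absorbˡ b a ⟩
    (b + a) % n         ≡⟨ cong (_% n) (+-comm b a) ⟩
    (a + b) % n         ∎
    where open ≡-Reasoning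

  +ₙ-assoc : ∀ x y z → (x +ₙ y) +ₙ z ≡ x +ₙ (y +ₙ z)
  +ₙ-assoc x y z = mod-cong (begin
    (toℕ (x +ₙ y) + toℕ z) % n          ≡⟨ cong (λ c → (c + toℕ z) % n) (toℕ-mod (toℕ x + toℕ y)) ⟩
    ((toℕ x + toℕ y) % n + toℕ z) % n   ≡⟨ %-absorbˡ (toℕ x + toℕ y) (toℕ z) ⟩
    (toℕ x + toℕ y + toℕ z) % n         ≡⟨ cong (_% n) (+-assoc (toℕ x) (toℕ y) (toℕ z)) ⟩
    (toℕ x + (toℕ y + toℕ z)) % n       ≡⟨ %-absorbʳ (toℕ x) (toℕ y + toℕ z) ⟨
    (toℕ x + (toℕ y + toℕ z) % n) % n   ≡⟨ cong (λ c → (toℕ x + c) % n) (toℕ-mod (toℕ y + toℕ z)) ⟨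
    (toℕ x + toℕ (y +ₙ z)) % n          ∎)
    where open ≡-Reasoning

  +ₙ-comm : ∀ x y → x +ₙ y ≡ y +ₙ x
  +ₙ-comm x y = cong (_mod n) (+-comm (toℕ x) (toℕ y))

  +ₙ-identityˡ : ∀ x → 0ₙ +ₙ x ≡ x
  +ₙ-identityˡ x = trans (cong (λ c → (c + toℕ x) mod n) toℕ-0ₙ) (mod-toℕ x)

  negₙ-inverseˡ : ∀ x → negₙ x +ₙ x ≡ 0ₙ
  negₙ-inverseˡ x = mod-cong (begin
    (toℕ (negₙ x) + toℕ x) % n       ≡⟨ cong (λ c → (c + toℕ x) % n) (toℕ-mod (n ∸ toℕ x)) ⟩
    ((n ∸ toℕ x) % n + toℕ x) % n    ≡⟨ %-absorbˡ (n ∸ toℕ x) (toℕ x) ⟩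
    (n ∸ toℕ x + toℕ x) % n          ≡⟨ cong (_% n) (m∸n+n≡m (<⇒≤ (toℕ<n x))) ⟩
    n % n                            ≡⟨ n%n≡0 n ⟩
    0                                ≡⟨ 0%n≡0 ⟨
    0 % n                            ∎)
    where open ≡-Reasoning

  +ₙ-isAbelianGroup : IsAbelianGroup _≡_ _+ₙ_ 0ₙ negₙ
  +ₙ-isAbelianGroup = record
    { isGroup = record
      { isMonoid = record
        { isSemigroup = record { isMagma = isMagma _+ₙ_ ; assoc = +ₙ-assoc }
        ; identity    = comm∧idˡ⇒id +ₙ-comm +ₙ-identityˡ
        }
      ; inverse = comm∧invˡ⇒inv +ₙ-comm negₙ-inverseˡ
      ; ⁻¹-cong = cong negₙ
      }
    ; comm = +ₙ-comm
    }

  +ₙ-abelianGroup : AbelianGroup 0ℓ 0ℓ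
  +ₙ-abelianGroup = record { isAbelianGroup = +ₙ-isAbelianGroup }

  -ₙ-as-+ₙ : ∀ y x → y -ₙ x ≡ y +ₙ negₙ x
  -ₙ-as-+ₙ y x = mod-cong (begin
    (toℕ y + (n ∸ toℕ x)) % n         ≡⟨ %-absorbʳ (toℕ y) (n ∸ toℕ x) ⟨
    (toℕ y + (n ∸ toℕ x) % n) % n     ≡⟨ cong (λ c → (toℕ y + c) % n) (toℕ-mod (n ∸ toℕ x)) ⟨
    (toℕ y + toℕ (negₙ x)) % n        ∎)
    where open ≡-Reasoning

module _ {n : ℕ} {{_ : NonZero n}} (2∣n : 2 ∣ n) where

  open ℤₙ n
  open AbelianGroup +ₙ-abelianGroup using (monoid; commutativeSemigroup; inverseˡ; inverseʳ; identityʳ)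
  open AbelianGroupLemmas +ₙ-abelianGroup
  open import Algebra.Properties.AbelianGroup +ₙ-abelianGroup using (ε⁻¹≈ε)
  open import Algebra.Properties.CommutativeSemigroup commutativeSemigroup using (x∙yz≈y∙xz)
  open import Algebra.Properties.Monoid monoid using (cancelʳ)
  open PartialSums monoid public using (sum≤)
  open PartialSums monoid using (sum≤-suc)

  par-mod : ∀ k → par (k mod n) ≡ k % 2
  par-mod k = trans (cong (_% 2) (toℕ-mod k)) (m∣n⇒o%n%m≡o%m 2 n k 2∣n)

  par-+ₙ : ∀ x y → par (x +ₙ y) ≡ (toℕ x + toℕ y) % 2
  par-+ₙ x y = par-mod (toℕ x + toℕ y)

  par-+ₙ-even : ∀ x y → par y ≡ 0 → par (x +ₙ y) ≡ par x
  par-+ₙ-even x y y-even = trans (par-+ₙ x y) (even+-%2 (toℕ x) (toℕ y) y-even)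

  par-+ₙ-odd : ∀ x y → par x ≡ 1 → par y ≡ 1 → par (x +ₙ y) ≡ 0
  par-+ₙ-odd x y x-odd y-odd = trans (par-+ₙ x y) (odd+odd-%2 (toℕ x) (toℕ y) x-odd y-odd)

  [n∸x]%2≡x%2 : ∀ {x} → x ≤ n → (n ∸ x) % 2 ≡ x % 2
  [n∸x]%2≡x%2 {x} x≤n = [a+b]%2≡0⇒a%2≡b%2 (n ∸ x) x
    (trans (cong (_% 2) (m∸n+n≡m x≤n)) (n∣m⇒m%n≡0 n 2 2∣n))

  [n∸1]%2≡1 : (n ∸ 1) % 2 ≡ 1
  [n∸1]%2≡1 = [n∸x]%2≡x%2 (>-nonZero⁻¹ n)

  par-negₙ : ∀ x → par (negₙ x) ≡ par x
  par-negₙ x = trans (par-mod (n ∸ toℕ x)) ([n∸x]%2≡x%2 (<⇒≤ (toℕ<n x)))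

  halfₙ : Fin n → Fin n
  halfₙ d = (toℕ d / 2) mod n

  halfₙ+halfₙ : ∀ d → par d ≡ 0 → halfₙ d +ₙ halfₙ d ≡ d
  halfₙ+halfₙ d d-even = trans (cong (λ k → (k + k) mod n) toℕ-half) (trans (cong (_mod n) k+k≡d) (mod-toℕ d))
    where
    toℕ-half : toℕ (halfₙ d) ≡ toℕ d / 2
    toℕ-half = trans (toℕ-mod (toℕ d / 2)) (m<n⇒m%n≡m (≤-<-trans (m/n≤m (toℕ d) 2) (toℕ<n d)))
    k+k≡d : toℕ d / 2 + toℕ d / 2 ≡ toℕ d
    k+k≡d = trans (sym (m*2≡m+m (toℕ d / 2))) (m/n*n≡m (m%n≡0⇒n∣m (toℕ d) 2 d-even))

  midpointₙ : Fin n
  midpointₙ = (n / 2) mod n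

  midpointₙ+midpointₙ : midpointₙ +ₙ midpointₙ ≡ 0ₙ
  midpointₙ+midpointₙ = mod-cong (begin
    (toℕ midpointₙ + toℕ midpointₙ) % n      ≡⟨ cong (λ k → (k + k) % n) (toℕ-mod (n / 2)) ⟩
    ((n / 2) % n + (n / 2) % n) % n          ≡⟨ %-distribˡ-+ (n / 2) (n / 2) n ⟨
    (n / 2 + n / 2) % n                      ≡⟨ cong (_% n) (trans (sym (m*2≡m+m (n / 2))) (m/n*n≡m 2∣n)) ⟩
    n % n                                    ≡⟨ n%n≡0 n ⟩
    0                                        ≡⟨ 0%n≡0 ⟨
    0 % n                                    ∎)
    where open ≡-Reasoning

  par-midpointₙ : ¬ 4 ∣ n → par midpointₙ ≡ 1
  par-midpointₙ 4∤n = trans (par-mod (n / 2)) ([m/2]%2≡1 n 2∣n 4∤n)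

  even-half-sum : ∀ a b → par a ≡ 1 → par b ≡ 1 → gcd (toℕ (b -ₙ a)) n ≡ 2 →
                  Σ[ h ∈ Fin n ] par h ≡ 0 × h +ₙ h ≡ a +ₙ b
  even-half-sum a b a-odd b-odd gcd≡2 = by-parity-of-k (%2≡0⊎%2≡1 (toℕ d / 2))
    where
    d k : Fin n
    d = b -ₙ a
    k = halfₙ d

    d-even : par d ≡ 0
    d-even = trans (cong par (-ₙ-as-+ₙ b a)) (par-+ₙ-odd b (negₙ a) b-odd (trans (par-negₙ a) a-odd))

    k+k≡b-a : k +ₙ k ≡ b +ₙ negₙ a
    k+k≡b-a = trans (halfₙ+halfₙ d d-even) (-ₙ-as-+ₙ b a)

    4∤n : (toℕ d / 2) % 2 ≡ 0 → ¬ 4 ∣ n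
    4∤n k-even 4∣n = >⇒∤ (s≤s (s≤s (s≤s z≤n))) (subst (4 ∣_) gcd≡2 (gcd-greatest 4∣d 4∣n))
      where
      4∣d : 4 ∣ toℕ d
      4∣d = 4∣m⇐2∣m∧2∣m/2 (toℕ d) (m%n≡0⇒n∣m (toℕ d) 2 d-even) (m%n≡0⇒n∣m (toℕ d / 2) 2 k-even)

    by-parity-of-k : (toℕ d / 2) % 2 ≡ 0 ⊎ (toℕ d / 2) % 2 ≡ 1 →
                     Σ[ h ∈ Fin n ] par h ≡ 0 × h +ₙ h ≡ a +ₙ b
    by-parity-of-k (inj₂ k-odd) =
      a +ₙ k , par-+ₙ-odd a k a-odd (trans (par-mod _) k-odd) , y∙y≈z∙x⁻¹⇒xy∙xy≈x∙z a k b k+k≡b-a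
    by-parity-of-k (inj₁ k-even) =
      a +ₙ k +ₙ midpointₙ ,
      par-+ₙ-odd (a +ₙ k) midpointₙ (trans (par-+ₙ-even a k (trans (par-mod _) k-even)) a-odd)
                                    (par-midpointₙ (4∤n k-even)) ,
      trans (y∙y≈ε⇒xy∙xy≈x∙x (a +ₙ k) midpointₙ midpointₙ+midpointₙ)
            (y∙y≈z∙x⁻¹⇒xy∙xy≈x∙z a k b k+k≡b-a)

  suc-%2≢ : ∀ k → suc k % 2 ≢ k % 2
  suc-%2≢ k = odd+-%2≢ 1 k refl

  par-+ₙ-odd≢ : ∀ x y → par y ≡ 1 → par (x +ₙ y) ≢ par x
  par-+ₙ-odd≢ x y y-odd eq =
    odd+-%2≢ (toℕ y) (toℕ x) y-odd (trans (cong (_% 2) (+-comm (toℕ y) (toℕ x))) (trans (sym (par-+ₙ x y)) eq))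

  sum< : ∀ {k} → (Fin k → Fin n) → Fin k → Fin n
  sum< f i = sum≤ f i +ₙ negₙ (f i)

  sum<-zero : ∀ {k} (f : Fin k → Fin n) i → toℕ i ≡ 0 → sum< f i ≡ 0ₙ
  sum<-zero f zero _ = inverseʳ (f zero)

  sum≤-even : ∀ {k} (f : Fin k → Fin n) → (∀ i → par (f i) ≡ 0) → ∀ i → par (sum≤ f i) ≡ 0
  sum≤-even f f-even zero    = f-even zero
  sum≤-even f f-even (suc i) = trans (par-+ₙ-even (f zero) _ (sum≤-even (f ∘ suc) (f-even ∘ suc) i)) (f-even zero)

  Is±1 : Fin n × Fin n → Set
  Is±1 (a , b) = (toℕ a ≡ 1 × toℕ b ≡ n ∸ 1) ⊎ (toℕ a ≡ n ∸ 1 × toℕ b ≡ 1)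

  Is±1⇒sum≡0 : ∀ x → Is±1 x → proj₁ x +ₙ proj₂ x ≡ 0ₙ
  Is±1⇒sum≡0 x ±1 = mod-cong (trans (cong (_% n) (toℕ-sum ±1)) (trans (n%n≡0 n) (sym 0%n≡0)))
    where
    toℕ-sum : Is±1 x → toℕ (proj₁ x) + toℕ (proj₂ x) ≡ n
    toℕ-sum (inj₁ (a≡1 , b≡n-1)) = trans (cong₂ _+_ a≡1 b≡n-1) (m+[n∸m]≡n (>-nonZero⁻¹ n))
    toℕ-sum (inj₂ (a≡n-1 , b≡1)) = trans (cong₂ _+_ a≡n-1 b≡1) (m∸n+n≡m (>-nonZero⁻¹ n))

  module _ {m : ℕ} where

    odd-entries : ∀ {S : Sig m n} {ℓ} → Admissible m n S ℓ →
                  ∀ i → par (proj₁ (S i)) ≡ 1 × par (proj₂ (S i)) ≡ 1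
    odd-entries {S} adm i with toℕ i ≟ 0
    ... | no i≢0 = Admissible.oddA adm i i≢0 , Admissible.oddB adm i i≢0
    ... | yes i≡0 with Admissible.row0 adm i i≡0
    ...   | inj₁ (a≡1 , b≡n-1) = cong (_% 2) a≡1 , trans (cong (_% 2) b≡n-1) [n∸1]%2≡1
    ...   | inj₂ (a≡n-1 , b≡1) = trans (cong (_% 2) a≡n-1) [n∸1]%2≡1 , cong (_% 2) b≡1

    shift : (p q : Fin m → Fin n) → Vtx m n → Vtx m n
    shift p q (i , j) with par j ≟ par i
    ... | yes _ = i , j +ₙ p i
    ... | no _  = i , j +ₙ q i

    shift-≡ : ∀ p q i j → par j ≡ par i → shift p q (i , j) ≡ (i , j +ₙ p i)
    shift-≡ p q i j j∼i with par j ≟ par i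
    ... | yes _   = refl
    ... | no j≁i  = contradiction j∼i j≁i

    shift-≢ : ∀ p q i j → par j ≢ par i → shift p q (i , j) ≡ (i , j +ₙ q i)
    shift-≢ p q i j j≁i with par j ≟ par i
    ... | yes j∼i = contradiction j∼i j≁i
    ... | no _    = refl

    record ShiftCompatible (S : Sig m n) (ℓ : Fin n) (S' : Sig m n) (ℓ' : Fin n)
                           (p q : Fin m → Fin n) : Set where
      field
        p-even : ∀ i → par (p i) ≡ 0
        q-even : ∀ i → par (q i) ≡ 0
        vert-compatible   : ∀ i i' → toℕ i' ≡ suc (toℕ i) → q i' ≡ p i
        wrap-compatible   : ∀ i i' → suc (toℕ i) ≡ m → toℕ i' ≡ 0 → ℓ +ₙ q i' ≡ p i +ₙ ℓ'
        chordA-compatible : ∀ i → proj₁ (S i) +ₙ q i ≡ p i +ₙ proj₁ (S' i)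
        chordB-compatible : ∀ i → proj₂ (S i) +ₙ q i ≡ p i +ₙ proj₂ (S' i)

    par≢-next-row : ∀ (i i' : Fin m) (j : Fin n) → toℕ i' ≡ suc (toℕ i) → par j ≡ par i → par j ≢ par i'
    par≢-next-row i i' j i'≡1+i j∼i j∼i' =
      suc-%2≢ (toℕ i) (trans (cong (_% 2) (sym i'≡1+i)) (trans (sym j∼i') j∼i))

    par≢-wrapped : ∀ (i i' : Fin m) (j ℓ : Fin n) → par ℓ ≡ m % 2 → suc (toℕ i) ≡ m → toℕ i' ≡ 0 →
                   par j ≡ par i → par (j +ₙ ℓ) ≢ par i'
    par≢-wrapped i i' j ℓ ℓ∼m 1+i≡m i'≡0 j∼i j+ℓ∼i' = suc-%2≢ (toℕ i) (begin
      suc (toℕ i) % 2    ≡⟨ cong (_% 2) 1+i≡m ⟩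
      m % 2              ≡⟨ ℓ∼m ⟨
      par ℓ              ≡⟨ j∼ℓ ⟨
      par j              ≡⟨ j∼i ⟩
      toℕ i % 2          ∎)
      where
      open ≡-Reasoning
      j∼ℓ : par j ≡ par ℓ
      j∼ℓ = [a+b]%2≡0⇒a%2≡b%2 (toℕ j) (toℕ ℓ)
              (trans (sym (par-+ₙ j ℓ)) (trans j+ℓ∼i' (cong (_% 2) i'≡0)))

    module _ {S S' : Sig m n} {ℓ ℓ' : Fin n} {p q : Fin m → Fin n} where

      shift-Edge : Admissible m n S ℓ → ShiftCompatible S ℓ S' ℓ' p q →
                   ∀ {x y} → Edge m n S ℓ x y → Edge m n S' ℓ' (shift p q x) (shift p q y)
      shift-Edge adm compat = go
        where
        open ShiftCompatible compat

        shifted : ∀ {i j i' y y'} → par j ≡ par i → par y ≢ par i' → y +ₙ q i' ≡ y' →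
                  Edge m n S' ℓ' (i , j +ₙ p i) (i' , y') →
                  Edge m n S' ℓ' (shift p q (i , j)) (shift p q (i' , y))
        shifted {i} {j} {i'} {y} j∼i y≁i' eq =
          subst₂ (Edge m n S' ℓ') (sym (shift-≡ p q i j j∼i))
                                  (sym (trans (shift-≢ p q i' y y≁i') (cong (i' ,_) eq)))

        source-par : ∀ {i j} → par j ≡ par i → par (j +ₙ p i) ≡ par i
        source-par {i} {j} j∼i = trans (par-+ₙ-even j (p i) (p-even i)) j∼i

        chord-par : ∀ i j c → par c ≡ 1 → par j ≡ par i → par (j +ₙ c) ≢ par i
        chord-par i j c c-odd j∼i e = par-+ₙ-odd≢ j c c-odd (trans e (sym j∼i))

        go : ∀ {x y} → Edge m n S ℓ x y → Edge m n S' ℓ' (shift p q x) (shift p q y)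
        go (vert i i' j i'≡1+i j∼i) =
          shifted j∼i (par≢-next-row i i' j i'≡1+i j∼i) (cong (j +ₙ_) (vert-compatible i i' i'≡1+i))
            (vert i i' (j +ₙ p i) i'≡1+i (source-par j∼i))
        go (wrap i i' j 1+i≡m i'≡0 j∼i) =
          shifted j∼i (par≢-wrapped i i' j ℓ (Admissible.ℓ-par adm) 1+i≡m i'≡0 j∼i)
            (y∙z≈u∙v⇒xy∙z≈xu∙v j ℓ (q i') (p i) ℓ' (wrap-compatible i i' 1+i≡m i'≡0))
            (wrap i i' (j +ₙ p i) 1+i≡m i'≡0 (source-par j∼i))
        go (chordA i j j∼i) =
          shifted j∼i (chord-par i j (proj₁ (S i)) (proj₁ (odd-entries adm i)) j∼i)
            (y∙z≈u∙v⇒xy∙z≈xu∙v j (proj₁ (S i)) (q i) (p i) (proj₁ (S' i)) (chordA-compatible i))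
            (chordA i (j +ₙ p i) (source-par j∼i))
        go (chordB i j j∼i) =
          shifted j∼i (chord-par i j (proj₂ (S i)) (proj₂ (odd-entries adm i)) j∼i)
            (y∙z≈u∙v⇒xy∙z≈xu∙v j (proj₂ (S i)) (q i) (p i) (proj₂ (S' i)) (chordB-compatible i))
            (chordB i (j +ₙ p i) (source-par j∼i))

      ShiftCompatible-inverse : ShiftCompatible S ℓ S' ℓ' p q →
                                ShiftCompatible S' ℓ' S ℓ (negₙ ∘ p) (negₙ ∘ q)
      ShiftCompatible-inverse compat = record
        { p-even            = λ i → trans (par-negₙ (p i)) (p-even i)
        ; q-even            = λ i → trans (par-negₙ (q i)) (q-even i)
        ; vert-compatible   = λ i i' i'≡1+i → cong negₙ (vert-compatible i i' i'≡1+i)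
        ; wrap-compatible   = λ i i' 1+i≡m i'≡0 →
            x∙y≈z∙w⇒w∙y⁻¹≈z⁻¹∙x ℓ (q i') (p i) ℓ' (wrap-compatible i i' 1+i≡m i'≡0)
        ; chordA-compatible = λ i →
            x∙y≈z∙w⇒w∙y⁻¹≈z⁻¹∙x (proj₁ (S i)) (q i) (p i) (proj₁ (S' i)) (chordA-compatible i)
        ; chordB-compatible = λ i →
            x∙y≈z∙w⇒w∙y⁻¹≈z⁻¹∙x (proj₂ (S i)) (q i) (p i) (proj₂ (S' i)) (chordB-compatible i)
        }
        where open ShiftCompatible compat

    shift-cancel : ∀ p q p' q' → (∀ i → par (p i) ≡ 0) → (∀ i → par (q i) ≡ 0) →
                   (∀ i → p i +ₙ p' i ≡ 0ₙ) → (∀ i → q i +ₙ q' i ≡ 0ₙ) →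
                   ∀ v → shift p' q' (shift p q v) ≡ v
    shift-cancel p q p' q' p-even q-even p+p'≡0 q+q'≡0 (i , j) with par j ≟ par i
    ... | yes j∼i = trans (shift-≡ p' q' i (j +ₙ p i) (trans (par-+ₙ-even j (p i) (p-even i)) j∼i))
                          (cong (i ,_) (cancelʳ (p+p'≡0 i) j))
    ... | no j≁i  = trans (shift-≢ p' q' i (j +ₙ q i)
                                   (λ e → j≁i (trans (sym (par-+ₙ-even j (q i) (q-even i))) e)))
                          (cong (i ,_) (cancelʳ (q+q'≡0 i) j))

    shift-isomorphism : ∀ {S S' ℓ ℓ' p q} → Admissible m n S ℓ → Admissible m n S' ℓ' →
                        ShiftCompatible S ℓ S' ℓ' p q → Isomorphic m n S ℓ S' ℓ'
    shift-isomorphism {S} {S'} {ℓ} {ℓ'} {p} {q} adm adm' compat =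
      mk↔ₛ′ (shift p q) (shift p' q')
        (shift-cancel p' q' p q (ShiftCompatible.p-even compat⁻¹) (ShiftCompatible.q-even compat⁻¹)
                      (λ i → inverseˡ (p i)) (λ i → inverseˡ (q i)))
        back ,
      λ x y → mk⇔ (Sum.map (shift-Edge adm compat) (shift-Edge adm compat))
                  (subst₂ (Adj m n S ℓ) (back x) (back y) ∘
                   Sum.map (shift-Edge adm' compat⁻¹) (shift-Edge adm' compat⁻¹))
      where
      p' q' : Fin m → Fin n
      p' = negₙ ∘ p
      q' = negₙ ∘ q
      compat⁻¹ : ShiftCompatible S' ℓ' S ℓ p' q'
      compat⁻¹ = ShiftCompatible-inverse compat
      back : ∀ v → shift p' q' (shift p q v) ≡ v
      back = shift-cancel p q p' q' (ShiftCompatible.p-even compat) (ShiftCompatible.q-even compat)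
                          (λ i → inverseʳ (p i)) (λ i → inverseʳ (q i))

    record EvenHalfSums (S : Sig m n) (h : Fin m → Fin n) : Set where
      field
        even    : ∀ i → par (h i) ≡ 0
        doubles : ∀ i → h i +ₙ h i ≡ proj₁ (S i) +ₙ proj₂ (S i)
        row0    : ∀ i → toℕ i ≡ 0 → h i ≡ 0ₙ

    even-half-sums : ∀ {S ℓ} → Admissible m n S ℓ → Σ[ h ∈ (Fin m → Fin n) ] EvenHalfSums S h
    even-half-sums {S} adm = h , record { even = even ; doubles = doubles ; row0 = row0 }
      where
      a b : Fin m → Fin n
      a i = proj₁ (S i)
      b i = proj₂ (S i)

      half : ∀ i → Dec (toℕ i ≡ 0) → Σ[ h ∈ Fin n ] par h ≡ 0 × h +ₙ h ≡ a i +ₙ b i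
      half i (yes i≡0) =
        0ₙ , par-mod 0 , trans (identityʳ 0ₙ) (sym (Is±1⇒sum≡0 (S i) (Admissible.row0 adm i i≡0)))
      half i (no i≢0) = even-half-sum (a i) (b i) (Admissible.oddA adm i i≢0) (Admissible.oddB adm i i≢0)
                                      (Admissible.gcd2 adm i i≢0)

      h : Fin m → Fin n
      h i = proj₁ (half i (toℕ i ≟ 0))
      even : ∀ i → par (h i) ≡ 0
      even i = proj₁ (proj₂ (half i (toℕ i ≟ 0)))
      doubles : ∀ i → h i +ₙ h i ≡ a i +ₙ b i
      doubles i = proj₂ (proj₂ (half i (toℕ i ≟ 0)))
      row0 : ∀ i → toℕ i ≡ 0 → h i ≡ 0ₙ
      row0 i i≡0 with toℕ i ≟ 0
      ... | yes _   = refl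
      ... | no i≢0  = contradiction i≡0 i≢0

    translate : Sig m n → (Fin m → Fin n) → Sig m n
    translate S h i = proj₁ (S i) +ₙ negₙ (h i) , proj₂ (S i) +ₙ negₙ (h i)

    translate-admissible : ∀ {S ℓ h} → Admissible m n S ℓ → EvenHalfSums S h →
                           ∀ t → par t ≡ 0 → Admissible m n (translate S h) (ℓ +ₙ negₙ t)
    translate-admissible {S} {ℓ} {h} adm halves t t-even = record
      { row0     = λ i i≡0 → subst Is±1 (sym (translate-row0 i i≡0)) (Admissible.row0 adm i i≡0)
      ; oddA     = λ i _ → trans (par-+ₙ-even (a i) (negₙ (h i)) (-h-even i)) (proj₁ (odd-entries adm i))
      ; oddB     = λ i _ → trans (par-+ₙ-even (b i) (negₙ (h i)) (-h-even i)) (proj₂ (odd-entries adm i))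
      ; distinct = λ i i≢0 a'≡b' → Admissible.distinct adm i i≢0
          (trans (sym (xy⁻¹∙y≈x (a i) (h i))) (trans (cong (_+ₙ h i) a'≡b') (xy⁻¹∙y≈x (b i) (h i))))
      ; gcd2     = λ i i≢0 → subst (λ d → gcd (toℕ d) n ≡ 2) (sym (difference i)) (Admissible.gcd2 adm i i≢0)
      ; ℓ-par    = trans (par-+ₙ-even ℓ (negₙ t) (trans (par-negₙ t) t-even)) (Admissible.ℓ-par adm)
      }
      where
      open EvenHalfSums halves
      a b : Fin m → Fin n
      a i = proj₁ (S i)
      b i = proj₂ (S i)

      -h-even : ∀ i → par (negₙ (h i)) ≡ 0
      -h-even i = trans (par-negₙ (h i)) (even i)

      translate-row0 : ∀ i → toℕ i ≡ 0 → translate S h i ≡ S i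
      translate-row0 i i≡0 = cong₂ _,_ (x-0≡x (a i)) (x-0≡x (b i))
        where
        x-0≡x : ∀ x → x +ₙ negₙ (h i) ≡ x
        x-0≡x x = trans (cong (λ z → x +ₙ negₙ z) (row0 i i≡0)) (trans (cong (x +ₙ_) ε⁻¹≈ε) (identityʳ x))

      difference : ∀ i → (b i +ₙ negₙ (h i)) -ₙ (a i +ₙ negₙ (h i)) ≡ b i -ₙ a i
      difference i = begin
        (b i +ₙ negₙ (h i)) -ₙ (a i +ₙ negₙ (h i))        ≡⟨ -ₙ-as-+ₙ (b i +ₙ negₙ (h i)) (a i +ₙ negₙ (h i)) ⟩
        b i +ₙ negₙ (h i) +ₙ negₙ (a i +ₙ negₙ (h i))     ≡⟨ xz⁻¹∙[yz⁻¹]⁻¹≈xy⁻¹ (b i) (a i) (h i) ⟩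
        b i +ₙ negₙ (a i)                                 ≡⟨ -ₙ-as-+ₙ (b i) (a i) ⟨
        b i -ₙ a i                                        ∎
        where open ≡-Reasoning

    translate-zero-sum : ∀ {S h} → EvenHalfSums S h →
                         ∀ i → proj₁ (translate S h i) +ₙ proj₂ (translate S h i) ≡ 0ₙ
    translate-zero-sum {S} {h} halves i =
      z∙z≈x∙y⇒xz⁻¹∙yz⁻¹≈ε (proj₁ (S i)) (proj₂ (S i)) (h i) (EvenHalfSums.doubles halves i)

    translate-compatible : ∀ {S ℓ h} (last : Fin m) → suc (toℕ last) ≡ m → (∀ i → par (h i) ≡ 0) →
                           ShiftCompatible S ℓ (translate S h) (ℓ +ₙ negₙ (sum≤ h last)) (sum≤ h) (sum< h)
    translate-compatible {S} {ℓ} {h} last 1+last≡m h-even = record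
      { p-even            = sum≤-even h h-even
      ; q-even            = λ i → trans (par-+ₙ-even (sum≤ h i) (negₙ (h i)) (trans (par-negₙ (h i)) (h-even i)))
                                        (sum≤-even h h-even i)
      ; vert-compatible   = λ i i' i'≡1+i →
          trans (cong (_+ₙ negₙ (h i')) (sum≤-suc h i i' i'≡1+i)) (xy∙y⁻¹≈x (sum≤ h i) (h i'))
      ; wrap-compatible   = λ i i' 1+i≡m i'≡0 → begin
          ℓ +ₙ sum< h i'                                 ≡⟨ cong (ℓ +ₙ_) (sum<-zero h i' i'≡0) ⟩
          ℓ +ₙ 0ₙ                                        ≡⟨ identityʳ ℓ ⟩
          ℓ                                              ≡⟨ x∙yx⁻¹≈y (sum≤ h last) ℓ ⟨
          sum≤ h last +ₙ (ℓ +ₙ negₙ (sum≤ h last))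
            ≡⟨ cong (λ r → sum≤ h r +ₙ (ℓ +ₙ negₙ (sum≤ h last))) (last≡i 1+i≡m) ⟩
          sum≤ h i +ₙ (ℓ +ₙ negₙ (sum≤ h last))          ∎
      ; chordA-compatible = λ i → x∙yz≈y∙xz (proj₁ (S i)) (sum≤ h i) (negₙ (h i))
      ; chordB-compatible = λ i → x∙yz≈y∙xz (proj₂ (S i)) (sum≤ h i) (negₙ (h i))
      }
      where
      open ≡-Reasoning
      last≡i : ∀ {i} → suc (toℕ i) ≡ m → last ≡ i
      last≡i 1+i≡m = toℕ-injective (suc-injective (trans 1+last≡m (sym 1+i≡m)))

corollary5p2 : (m n : ℕ) {{_ : NonZero n}} → 3 ≤ m → 4 ≤ n → n % 2 ≡ 0 →
    (S : Sig m n) (ℓ : Fin n) → Admissible m n S ℓ →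
    ∃ λ (ℓ' : Fin n) → ∃ λ (S' : Sig m n) →
    Admissible m n S' ℓ'
    × (∀ (i : Fin m) → toℕ ((n ⊕ proj₁ (S' i)) (proj₂ (S' i))) ≡ 0)
    × Isomorphic m n S ℓ S' ℓ'
corollary5p2 zero    _ ()
corollary5p2 (suc k) n _ _ n-even S ℓ adm =
  ℓ +ₙ negₙ t , translate 2∣n S h , adm' ,
  (λ i → trans (cong toℕ (translate-zero-sum 2∣n halves i)) toℕ-0ₙ) ,
  shift-isomorphism 2∣n adm adm'
    (translate-compatible 2∣n (fromℕ k) (cong suc (toℕ-fromℕ k)) (EvenHalfSums.even halves))
  where
  open ℤₙ n
  2∣n : 2 ∣ n
  2∣n = m%n≡0⇒n∣m n 2 n-even
  h : Fin (suc k) → Fin n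
  h = proj₁ (even-half-sums 2∣n adm)
  halves : EvenHalfSums 2∣n S h
  halves = proj₂ (even-half-sums 2∣n adm)
  t : Fin n
  t = sum≤ 2∣n h (fromℕ k)
  adm' : Admissible (suc k) n (translate 2∣n S h) (ℓ +ₙ negₙ t)
  adm' = translate-admissible 2∣n adm halves t (sum≤-even 2∣n h (EvenHalfSums.even halves) (fromℕ k))
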